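{- Let $p_0,p_1,p_2$ be positive integers with $\gcd(p_0,p_1,p_2)=1$, and put $n=p_0+p_1+p_2$. Let $E=(\mathbb{Z}/n\mathbb{Z})\times\{0,1,2\}$, and let $\sigma_0,\sigma_1$ be the permutations of $E$ defined for $m\in\mathbb{Z}/n\mathbb{Z}$ by $$\sigma_0(m,0)=(m,1),\quad \sigma_0(m,1)=(m,2),\quad \sigma_0(m,2)=(m,0),$$ $$\sigma_1(m,0)=(m-p_1,2),\quad \sigma_1(m,1)=(m-p_2,0),\quad \sigma_1(m,2)=(m-p_0,1).$$ Let $G=\langle\sigma_0,\sigma_1\rangle$, $N=\langle\sigma_0\sigma_1,\sigma_1\sigma_0\rangle$ and $H=\langle\sigma_0\rangle$. Then $G=N\rtimes H$ (i.e. $N\lhd G$, $N\cap H=\{\mathrm{id}\}$, $NH=G$). Furthermore, if $\alpha=\gcd(n,p_0p_1-p_2^2)$, then $$G\cong (C_n\times C_{n/\alpha})\rtimes C_3,$$ where $C_k$ denotes the cyclic group of order $k$.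
   Context: The group $G$ is the monodromy group of the dessin d'enfant (bicolored graph) drawn on the billiards surface of the rational triangle with angles $\frac{p_0\pi}{n},\frac{p_1\pi}{n},\frac{p_2\pi}{n}$: the edges of the dessin are labeled $(m,i)$, where $m$ indexes the black vertex (the rotated copy of the triangle) and $i$ the side of the triangle crossed by the edge, and $\sigma_0,\sigma_1$ rotate edges about black and white vertices respectively; the formulas above are this action. Composition of permutations is as functions: $(\sigma\tau)(x)=\sigma(\tau(x))$. -}

module Defs where

open import Data.Nat using (ℕ; zero; suc; _+_; _*_; _∸_; _%_)
open import Data.Nat.DivMod using (m%n<n)
open import Data.Fin using (Fin; toℕ; fromℕ<) renaming (zero to f0; suc to fs)
open import Data.Product using (_×_; _,_; Σ)
open import Data.Sum using (_⊎_)
open import Function using (id; _∘_)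
open import Relation.Binary.PropositionalEquality using (_≡_)

-- Z/kZ is represented by Fin k (residues 0..k-1).
-- Reduction of a natural number modulo k (k > 0 is witnessed by any element of Fin k).
modFin : ∀ {k} → Fin k → ℕ → Fin k
modFin {suc k} _ m = fromℕ< (m%n<n m (suc k))

_+ₘ_ : ∀ {k} → Fin k → Fin k → Fin k
a +ₘ b = modFin a (toℕ a + toℕ b)

_-ₘ_ : ∀ {k} → Fin k → ℕ → Fin k
_-ₘ_ {k} a p = modFin a (toℕ a + (k ∸ toℕ (modFin a p)))

Edge : ℕ → Set
Edge n = Fin n × Fin 3

σ₀ : ∀ {n} → Edge n → Edge n
σ₀ (m , f0) = (m , fs f0)
σ₀ (m , fs f0) = (m , fs (fs f0))
σ₀ (m , fs (fs f0)) = (m , f0)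

σ₁ : ∀ p₀ p₁ p₂ → Edge (p₀ + p₁ + p₂) → Edge (p₀ + p₁ + p₂)
σ₁ p₀ p₁ p₂ (m , f0) = (m -ₘ p₁ , fs (fs f0))
σ₁ p₀ p₁ p₂ (m , fs f0) = (m -ₘ p₂ , f0)
σ₁ p₀ p₁ p₂ (m , fs (fs f0)) = (m -ₘ p₀ , fs f0)

_≈_ : ∀ {A : Set} → (A → A) → (A → A) → Set
f ≈ g = ∀ x → f x ≡ g x
infix 4 _≈_

data Gen {A : Set} (S : (A → A) → Set) : (A → A) → Set where
  gen  : ∀ {f} → S f → Gen S f
  one  : Gen S id
  comp : ∀ {f g} → Gen S f → Gen S g → Gen S (f ∘ g)
  inv  : ∀ {f g} → Gen S f → (f ∘ g) ≈ id → (g ∘ f) ≈ id → Gen S g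
  ext  : ∀ {f g} → Gen S f → f ≈ g → Gen S g

Gens1 : ∀ {A : Set} → (A → A) → (A → A) → Set
Gens1 a f = f ≡ a

Gens2 : ∀ {A : Set} → (A → A) → (A → A) → (A → A) → Set
Gens2 a b f = f ≡ a ⊎ f ≡ b

G : ∀ p₀ p₁ p₂ → (Edge (p₀ + p₁ + p₂) → Edge (p₀ + p₁ + p₂)) → Set
G p₀ p₁ p₂ = Gen (Gens2 σ₀ (σ₁ p₀ p₁ p₂)) 

N : ∀ p₀ p₁ p₂ → (Edge (p₀ + p₁ + p₂) → Edge (p₀ + p₁ + p₂)) → Set
N p₀ p₁ p₂ = Gen (Gens2 (σ₀ ∘ σ₁ p₀ p₁ p₂) (σ₁ p₀ p₁ p₂ ∘ σ₀)) 

H : ∀ p₀ p₁ p₂ → (Edge (p₀ + p₁ + p₂) → Edge (p₀ + p₁ + p₂)) → Set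
H p₀ p₁ p₂ = Gen (Gens1 σ₀)

record InternalSemidirect {A : Set} (G N H : (A → A) → Set) : Set where
  field
    N⊆G     : ∀ {x} → N x → G x
    H⊆G     : ∀ {x} → H x → G x
    normal  : ∀ {g g' x} → G g → (g ∘ g') ≈ id → (g' ∘ g) ≈ id → N x → N (g ∘ x ∘ g')
    N∩H     : ∀ {x} → N x → H x → x ≈ id
    NH⊆G    : ∀ {a h} → N a → H h → G (a ∘ h)
    G⊆NH    : ∀ {g} → G g → Σ (A → A) (λ a → Σ (A → A) (λ h → N a × H h × g ≈ a ∘ h))

_⊕_ : ∀ {a b} → Fin a × Fin b → Fin a × Fin b → Fin a × Fin b
(x , y) ⊕ (x' , y') = (x +ₘ x' , y +ₘ y')

-- An action of C₃ = Z/3 on C_a × C_b by group automorphisms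
-- (a homomorphism C₃ → Aut(C_a × C_b); bijectivity of each φ h follows from
-- φ-zero and φ-add since C₃ is a group).
record C₃Action (a b : ℕ) : Set where
  field
    φ      : Fin 3 → Fin a × Fin b → Fin a × Fin b
    φ-hom  : ∀ h x y → φ h (x ⊕ y) ≡ φ h x ⊕ φ h y
    φ-zero : ∀ x → φ f0 x ≡ x
    φ-add  : ∀ h h' x → φ (h +ₘ h') x ≡ φ h (φ h' x)

SD : ℕ → ℕ → Set
SD a b = (Fin a × Fin b) × Fin 3

sdMul : ∀ {a b} → C₃Action a b → SD a b → SD a b → SD a b
sdMul act (x , h) (y , h') = (x ⊕ C₃Action.φ act h y , h +ₘ h')

record IsoOnto {X A : Set} (_·_ : X → X → X) (K : (A → A) → Set) : Set where
  field
    to       : X → (A → A)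
    to-in    : ∀ x → K (to x)
    to-hom   : ∀ x y → to (x · y) ≈ (to x ∘ to y)
    to-inj   : ∀ x y → to x ≈ to y → x ≡ y
    to-surj  : ∀ {g} → K g → Σ X (λ x → to x ≈ g)

{-# OPTIONS --safe #-}
module Submission where

-- Every element of G acts on Z/n × Z/3 as an affine map (m, i) ↦ (m + vᵢ, i + r) with v ∈ ℤ³
-- and r ∈ Z/3: σ₀ is the rotation r = 1, σ₁ has v = -a and r = 2 for a = (p₁, p₂, p₀), and
-- σ₀σ₁, σ₁σ₀ are the translations by -a and -b, b the cyclic shift of a.  Composition twists
-- translation vectors by cyclic shifts, so G consists exactly of the affine maps with v in the
-- lattice L = ℤa + ℤb + nℤ³, N of its translations and H of the rotations; this gives G = N ⋊ H,
-- with H acting on N ≅ L/nℤ³ by cyclic shifts.  Finally L/nℤ³ ≅ Z/n × Z/k: a vector of L is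
-- determined mod n by its last coordinate t and the first coordinate of v - tℓ, where ℓ ∈ L has
-- last coordinate 1 (Bézout for p₀, p₁, p₂); that coordinate is a multiple of α, since α divides
-- n and p₀p₁ - p₂² and is coprime to p₁, and every multiple occurs because α(1, -1, 0) ∈ L.

open import Defs

-- Integer arithmetic is opened only inside this block, so that the statement below can use the
-- natural-number operators.
module _ where

  open import Data.Nat as ℕ using (ℕ; zero; suc; NonZero)
  import Data.Nat.Properties as ℕ
  open import Data.Nat.DivMod using (m<n⇒m%n≡m)
  import Data.Nat.Divisibility as ℕ
  open import Data.Nat.GCD using (gcd; gcd-GCD; gcd[m,n]∣m; gcd[m,n]∣n; gcd-greatest; module Bézout)
  open import Data.Nat.Coprimality using (Coprime; coprime-divisor)
  open import Data.Integer as ℤ using (ℤ; +_; _+_; _*_; -_; _-_; 0ℤ; 1ℤ; _⊖_)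
  import Data.Integer.Properties as ℤ
  import Data.Integer.Coprimality as ℤ using (coprime-divisor)
  open import Data.Integer.DivMod using (n%ℕd<d; a≡a%ℕn+[a/ℕn]*n)
  open import Data.Integer.Divisibility.Signed
  open import Data.Integer.Tactic.RingSolver using (solve-∀)
  open import Data.Fin as F using (Fin; toℕ; fromℕ<) renaming (zero to f0; suc to fs)
  import Data.Fin.Properties as F
  open import Data.Fin.Properties using (all?)
  open import Data.Product using (Σ; ∃₂; _,_; proj₁; proj₂; _×_)
  open import Data.Sum using (inj₁; inj₂)
  open import Data.Unit using (⊤; tt)
  open import Function using (id; _∘_)
  open import Relation.Nullary.Decidable using (toWitness)
  open import Relation.Binary.PropositionalEquality
  open import Relation.Binary.Bundles using (Setoid)
  import Relation.Binary.Reasoning.Setoid as SetoidReasoning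

  infix 4 _≡_[mod_]

  -- A record rather than an abbreviation of + d ∣ x - y, so that x and y can be inferred.

  record _≡_[mod_] (x y : ℤ) (d : ℕ) : Set where
    constructor mod
    field divides-difference : + d ∣ x - y

  module _ {d : ℕ} where

    mod-reflexive : ∀ {x y} → x ≡ y → x ≡ y [mod d ]
    mod-reflexive {x} refl = mod (divides 0ℤ (ℤ.+-inverseʳ x))

    mod-refl : ∀ {x} → x ≡ x [mod d ]
    mod-refl = mod-reflexive refl

    mod-sym : ∀ {x y} → x ≡ y [mod d ] → y ≡ x [mod d ]
    mod-sym {x} {y} (mod x≡y) = mod (subst (+ d ∣_) (lemma x y) (∣m⇒∣-m x≡y))
      where lemma : ∀ x y → - (x - y) ≡ y - x
            lemma = solve-∀

    mod-trans : ∀ {x y z} → x ≡ y [mod d ] → y ≡ z [mod d ] → x ≡ z [mod d ]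
    mod-trans {x} {y} {z} (mod x≡y) (mod y≡z) = mod (subst (+ d ∣_) (lemma x y z) (∣m∣n⇒∣m+n x≡y y≡z))
      where lemma : ∀ x y z → (x - y) + (y - z) ≡ x - z
            lemma = solve-∀

    mod-+ : ∀ {x y u w} → x ≡ y [mod d ] → u ≡ w [mod d ] → x + u ≡ y + w [mod d ]
    mod-+ {x} {y} {u} {w} (mod x≡y) (mod u≡w) = mod (subst (+ d ∣_) (lemma x y u w) (∣m∣n⇒∣m+n x≡y u≡w))
      where lemma : ∀ x y u w → (x - y) + (u - w) ≡ (x + u) - (y + w)
            lemma = solve-∀

    mod-*ˡ : ∀ c {x y} → x ≡ y [mod d ] → c * x ≡ c * y [mod d ]
    mod-*ˡ c {x} {y} (mod x≡y) = mod (subst (+ d ∣_) (lemma c x y) (∣n⇒∣m*n c x≡y))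
      where lemma : ∀ c x y → c * (x - y) ≡ c * x - c * y
            lemma = solve-∀

    mod-*ʳ : ∀ c {x y} → x ≡ y [mod d ] → x * c ≡ y * c [mod d ]
    mod-*ʳ c {x} {y} x≡y = subst₂ _≡_[mod d ] (ℤ.*-comm c x) (ℤ.*-comm c y) (mod-*ˡ c x≡y)

    mod-neg : ∀ {x y} → x ≡ y [mod d ] → - x ≡ - y [mod d ]
    mod-neg {x} {y} (mod x≡y) = mod (subst (+ d ∣_) (lemma x y) (∣m⇒∣-m x≡y))
      where lemma : ∀ x y → - (x - y) ≡ - x - - y
            lemma = solve-∀

    mod-cancelˡ : ∀ {z x y} → z + x ≡ z + y [mod d ] → x ≡ y [mod d ]
    mod-cancelˡ {z} {x} {y} (mod p) = mod (subst (+ d ∣_) (lemma z x y) p)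
      where lemma : ∀ z x y → (z + x) - (z + y) ≡ x - y
            lemma = solve-∀

    modulus≡0 : + d ≡ 0ℤ [mod d ]
    modulus≡0 = mod (divides 1ℤ (trans (ℤ.+-identityʳ (+ d)) (sym (ℤ.*-identityˡ (+ d)))))

  mod-*-scale : ∀ {d x y} c → x ≡ y [mod d ] → x * + c ≡ y * + c [mod d ℕ.* c ]
  mod-*-scale {d} {x} {y} c (mod x≡y) =
    mod (subst₂ _∣_ (sym (ℤ.pos-* d c)) (lemma x y (+ c)) (*-monoˡ-∣ (+ c) x≡y))
    where lemma : ∀ x y c → (x - y) * c ≡ x * c - y * c
          lemma = solve-∀

  mod-*-cancel : ∀ {d x y} c .{{_ : NonZero c}} → x * + c ≡ y * + c [mod d ℕ.* c ] → x ≡ y [mod d ]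
  mod-*-cancel {d} {x} {y} c (mod dc∣xc-yc) =
    mod (*-cancelʳ-∣ (+ c) (subst₂ _∣_ (ℤ.pos-* d c) (sym (lemma x y (+ c))) dc∣xc-yc))
    where lemma : ∀ x y c → (x - y) * c ≡ x * c - y * c
          lemma = solve-∀

  ∣-resp-mod : ∀ {m d x y} → + m ∣ + d → x ≡ y [mod d ] → + m ∣ y → + m ∣ x
  ∣-resp-mod {m} {d} {x} {y} m∣d (mod d∣x-y) m∣y =
    subst (+ m ∣_) (lemma x y) (∣m∣n⇒∣m+n (∣-trans m∣d d∣x-y) m∣y)
    where lemma : ∀ x y → x - y + y ≡ x
          lemma = solve-∀

  toℤ : ∀ {d} → Fin d → ℤ
  toℤ m = + toℕ m

  residue-unique : ∀ {d r s} → r ℕ.< d → s ℕ.< d → + r ≡ + s [mod d ] → r ≡ s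
  residue-unique {d} {r} {s} r<d s<d (mod d∣r-s) =
    ℤ.+-injective (ℤ.i-j≡0⇒i≡j (+ r) (+ s) (ℤ.∣i∣≡0⇒i≡0 ∣r-s∣≡0))
    where
      instance
        _ : NonZero d
        _ = ℕ.>-nonZero (ℕ.≤-<-trans ℕ.z≤n r<d)
      ∣r-s∣<d : ℤ.∣ + r - + s ∣ ℕ.< d
      ∣r-s∣<d = subst (ℕ._< d) (cong ℤ.∣_∣ (sym (ℤ.m-n≡m⊖n r s)))
                  (ℕ.≤-<-trans (ℤ.∣m⊝n∣≤m⊔n r s) (ℕ.⊔-lub r<d s<d))
      ∣r-s∣≡0 : ℤ.∣ + r - + s ∣ ≡ 0
      ∣r-s∣≡0 = trans (sym (m<n⇒m%n≡m ∣r-s∣<d)) (ℕ.n∣m⇒m%n≡0 _ d (∣⇒∣ᵤ d∣r-s))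

  toℤ-injective-mod : ∀ {d} {a b : Fin d} → toℤ a ≡ toℤ b [mod d ] → a ≡ b
  toℤ-injective-mod {a = a} {b} a≡b = F.toℕ-injective (residue-unique (F.toℕ<n a) (F.toℕ<n b) a≡b)

  toℕ-modFin : ∀ {d} .{{_ : NonZero d}} (m : Fin d) x → toℕ (modFin m x) ≡ x ℕ.% d
  toℕ-modFin {suc d} m x = F.toℕ-fromℕ< _

  +[x%ℕd]≡x : ∀ x d .{{_ : NonZero d}} → + (x ℤ.%ℕ d) ≡ x [mod d ]
  +[x%ℕd]≡x x d = mod (divides (- (x ℤ./ℕ d)) (rearrange x (+ (x ℤ.%ℕ d)) (x ℤ./ℕ d) (a≡a%ℕn+[a/ℕn]*n x d)))
    where rearrange : ∀ x r q → x ≡ r + q * + d → r - x ≡ - q * + d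
          rearrange _ r q refl = lemma r q (+ d)
            where lemma : ∀ r q d → r - (r + q * d) ≡ - q * d
                  lemma = solve-∀

  /ℕ-exact : ∀ {x d} .{{_ : NonZero d}} → + d ∣ x → (x ℤ./ℕ d) * + d ≡ x
  /ℕ-exact {x} {d} d∣x = sym (begin
    x                                ≡⟨ a≡a%ℕn+[a/ℕn]*n x d ⟩
    + (x ℤ.%ℕ d) + (x ℤ./ℕ d) * + d  ≡⟨ cong (λ r → + r + (x ℤ./ℕ d) * + d) remainder≡0 ⟩
    0ℤ + (x ℤ./ℕ d) * + d            ≡⟨ ℤ.+-identityˡ _ ⟩
    (x ℤ./ℕ d) * + d                 ∎)
    where
      open ≡-Reasoning
      x≡0 : x ≡ 0ℤ [mod d ]
      x≡0 = mod (subst (+ d ∣_) (sym (ℤ.+-identityʳ x)) d∣x)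
      remainder≡0 : x ℤ.%ℕ d ≡ 0
      remainder≡0 = residue-unique (n%ℕd<d x d) (ℕ.>-nonZero⁻¹ d) (mod-trans (+[x%ℕd]≡x x d) x≡0)

  module Residue (d : ℕ) .{{_ : NonZero d}} where

    residue : ℤ → Fin d
    residue x = fromℕ< (n%ℕd<d x d)

    toℤ-residue : ∀ x → toℤ (residue x) ≡ x [mod d ]
    toℤ-residue x = mod-trans (mod-reflexive (cong +_ (F.toℕ-fromℕ< (n%ℕd<d x d)))) (+[x%ℕd]≡x x d)

    residue-cong : ∀ {x y} → x ≡ y [mod d ] → residue x ≡ residue y
    residue-cong {x} {y} x≡y =
      toℤ-injective-mod (mod-trans (toℤ-residue x) (mod-trans x≡y (mod-sym (toℤ-residue y))))

    residue-injective : ∀ {x y} → residue x ≡ residue y → x ≡ y [mod d ]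
    residue-injective {x} {y} eq =
      mod-trans (mod-sym (toℤ-residue x)) (mod-trans (mod-reflexive (cong toℤ eq)) (toℤ-residue y))

    residue-toℤ : ∀ m → residue (toℤ m) ≡ m
    residue-toℤ m = toℤ-injective-mod (toℤ-residue (toℤ m))

    modFin≡residue : ∀ (m : Fin d) x → modFin m x ≡ residue (+ x)
    modFin≡residue m x = F.toℕ-injective (trans (toℕ-modFin m x) (sym (F.toℕ-fromℕ< _)))

    toℤ-+ₘ : ∀ (a b : Fin d) → toℤ (a +ₘ b) ≡ toℤ a + toℤ b [mod d ]
    toℤ-+ₘ a b = mod-trans (mod-reflexive (cong toℤ (modFin≡residue a (toℕ a ℕ.+ toℕ b))))
                  (mod-trans (toℤ-residue _) (mod-reflexive (ℤ.pos-+ (toℕ a) (toℕ b))))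

    -ₘ≡residue : ∀ (a : Fin d) p → a -ₘ p ≡ residue (toℤ a - + p)
    -ₘ≡residue a p = trans (modFin≡residue a _) (residue-cong (mod-trans (mod-reflexive unfold) d-r≡-p))
      where
        r : ℕ
        r = toℕ (modFin a p)
        unfold : + (toℕ a ℕ.+ (d ℕ.∸ r)) ≡ toℤ a + (+ d - + r)
        unfold = trans (ℤ.pos-+ (toℕ a) (d ℕ.∸ r))
                   (cong (_+_ (toℤ a)) (trans (sym (ℤ.⊖-≥ (ℕ.<⇒≤ (F.toℕ<n (modFin a p))))) (sym (ℤ.m-n≡m⊖n d r))))
        r≡p : + r ≡ + p [mod d ]
        r≡p = mod-trans (mod-reflexive (cong toℤ (modFin≡residue a p))) (toℤ-residue (+ p))
        d-r≡-p : toℤ a + (+ d - + r) ≡ toℤ a - + p [mod d ]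
        d-r≡-p = mod-+ (mod-refl {x = toℤ a}) (mod-trans (mod-+ modulus≡0 (mod-neg r≡p)) (mod-reflexive (ℤ.+-identityˡ (- + p))))

  private
    lift-identity : ∀ {g x m y n} → g ℕ.+ y ℕ.* n ≡ x ℕ.* m → + g ≡ + x * + m + - + y * + n
    lift-identity {g} {x} {m} {y} {n} eq = begin
      + g                                  ≡⟨ lemma (+ g) (+ y) (+ n) ⟩
      (+ g + + y * + n) + - + y * + n      ≡⟨ cong (λ z → z + - + y * + n) lifted ⟩
      + x * + m + - + y * + n              ∎
      where
        open ≡-Reasoning
        lemma : ∀ g y n → g ≡ (g + y * n) + - y * n
        lemma = solve-∀
        lifted : + g + + y * + n ≡ + x * + m
        lifted = trans (cong (_+_ (+ g)) (sym (ℤ.pos-* y n)))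
                   (trans (sym (ℤ.pos-+ g (y ℕ.* n))) (trans (cong +_ eq) (ℤ.pos-* x m)))

  bézout : ∀ m n → ∃₂ λ A B → + gcd m n ≡ A * + m + B * + n
  bézout m n with Bézout.identity (gcd-GCD m n)
  ... | Bézout.+- x y eq = + x , - + y , lift-identity {x = x} {m} {y} {n} eq
  ... | Bézout.-+ x y eq = - + x , + y , trans (lift-identity {x = y} {n} {x} {m} eq) (ℤ.+-comm (+ y * + n) (- + x * + m))

  ∣⊖∣≡∣-∣ : ∀ m n → ℤ.∣ m ⊖ n ∣ ≡ ℕ.∣ m - n ∣
  ∣⊖∣≡∣-∣ m n with ℕ.≤-total m n
  ... | inj₁ m≤n = trans (ℤ.∣⊖∣-≤ m≤n) (sym (ℕ.m≤n⇒∣m-n∣≡n∸m m≤n))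
  ... | inj₂ n≤m = trans (ℤ.∣m⊖n∣≡∣n⊖m∣ m n)
                     (trans (ℤ.∣⊖∣-≤ n≤m) (sym (trans (ℕ.∣-∣-comm m n) (ℕ.m≤n⇒∣m-n∣≡n∸m n≤m))))

  ∣+m-+n∣≡∣m-n∣ : ∀ m n → ℤ.∣ + m - + n ∣ ≡ ℕ.∣ m - n ∣
  ∣+m-+n∣≡∣m-n∣ m n = trans (cong ℤ.∣_∣ (ℤ.m-n≡m⊖n m n)) (∣⊖∣≡∣-∣ m n)

  gcd-bézout-∣∣ : ∀ m z → ∃₂ λ A B → + gcd m ℤ.∣ z ∣ ≡ A * + m + B * z
  gcd-bézout-∣∣ m z with bézout m ℤ.∣ z ∣ | ℤ.+∣i∣≡i⊎+∣i∣≡-i z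
  ... | A , B , eq | inj₁ ∣z∣≡z = A , B , trans eq (cong (λ w → A * + m + B * w) ∣z∣≡z)
  ... | A , B , eq | inj₂ ∣z∣≡-z = A , - B , (begin
    + gcd m ℤ.∣ z ∣      ≡⟨ eq ⟩
    A * + m + B * + ℤ.∣ z ∣ ≡⟨ cong (λ w → A * + m + B * w) ∣z∣≡-z ⟩
    A * + m + B * - z    ≡⟨ cong (_+_ (A * + m)) (trans (sym (ℤ.neg-distribʳ-* B z)) (ℤ.neg-distribˡ-* B z)) ⟩
    A * + m + - B * z    ∎)
    where open ≡-Reasoning

  -₃_ : Fin 3 → Fin 3
  -₃ f0 = f0
  -₃ fs f0 = fs (fs f0)
  -₃ fs (fs f0) = fs f0

  +₃-assoc : ∀ (a b c : Fin 3) → (a +ₘ b) +ₘ c ≡ a +ₘ (b +ₘ c)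
  +₃-assoc = toWitness {a? = all? λ a → all? λ b → all? λ c → (a +ₘ b) +ₘ c F.≟ a +ₘ (b +ₘ c)} _

  +₃-comm : ∀ (a b : Fin 3) → a +ₘ b ≡ b +ₘ a
  +₃-comm = toWitness {a? = all? λ a → all? λ b → a +ₘ b F.≟ b +ₘ a} _

  +₃-identityʳ : ∀ (a : Fin 3) → a +ₘ f0 ≡ a
  +₃-identityʳ = toWitness {a? = all? λ a → a +ₘ f0 F.≟ a} _

  +₃-identityˡ : ∀ (a : Fin 3) → f0 +ₘ a ≡ a
  +₃-identityˡ a = trans (+₃-comm f0 a) (+₃-identityʳ a)

  +₃-inverseʳ : ∀ (a : Fin 3) → a +ₘ (-₃ a) ≡ f0
  +₃-inverseʳ = toWitness {a? = all? λ a → a +ₘ (-₃ a) F.≟ f0} _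

  +₃-inverseˡ : ∀ (a : Fin 3) → (-₃ a) +ₘ a ≡ f0
  +₃-inverseˡ a = trans (+₃-comm (-₃ a) a) (+₃-inverseʳ a)

  +₃-rotate : ∀ (i r r′ : Fin 3) → i +ₘ (r +ₘ r′) ≡ (i +ₘ r′) +ₘ r
  +₃-rotate = toWitness {a? = all? λ i → all? λ r → all? λ r′ → i +ₘ (r +ₘ r′) F.≟ (i +ₘ r′) +ₘ r} _

  +₃-cancel : ∀ (i r r′ : Fin 3) → (i +ₘ (r +ₘ r′)) +ₘ (-₃ r) ≡ i +ₘ r′
  +₃-cancel = toWitness {a? = all? λ i → all? λ r → all? λ r′ → (i +ₘ (r +ₘ r′)) +ₘ (-₃ r) F.≟ i +ₘ r′} _

  -₃-+ : ∀ (a b : Fin 3) → -₃ (a +ₘ b) ≡ (-₃ a) +ₘ (-₃ b)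
  -₃-+ = toWitness {a? = all? λ a → all? λ b → -₃ (a +ₘ b) F.≟ (-₃ a) +ₘ (-₃ b)} _

  V₃ : Set
  V₃ = Fin 3 → ℤ

  0ᵥ : V₃
  0ᵥ _ = 0ℤ

  infixl 6 _+ᵥ_
  infixl 7 _*ᵥ_

  _+ᵥ_ : V₃ → V₃ → V₃
  (v +ᵥ w) i = v i + w i

  -ᵥ_ : V₃ → V₃
  (-ᵥ v) i = - v i

  _*ᵥ_ : ℤ → V₃ → V₃
  (z *ᵥ v) i = z * v i

  shift : Fin 3 → V₃ → V₃
  shift s v i = v (i +ₘ s)

  infix 4 _≡ᵥ_[mod_]

  _≡ᵥ_[mod_] : V₃ → V₃ → ℕ → Set
  v ≡ᵥ w [mod d ] = ∀ i → v i ≡ w i [mod d ]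

  shift-shift : ∀ r s v i → shift r (shift s v) i ≡ shift (r +ₘ s) v i
  shift-shift r s v i = cong v (+₃-assoc i r s)

  shift-identity : ∀ v i → shift f0 v i ≡ v i
  shift-identity v i = cong v (+₃-identityʳ i)

  shift-inverseʳ : ∀ r v i → shift r (shift (-₃ r) v) i ≡ v i
  shift-inverseʳ r v i = trans (shift-shift r (-₃ r) v i) (trans (cong (λ s → shift s v i) (+₃-inverseʳ r)) (shift-identity v i))

  shift-inverseˡ : ∀ r v i → shift (-₃ r) (shift r v) i ≡ v i
  shift-inverseˡ r v i = trans (shift-shift (-₃ r) r v i) (trans (cong (λ s → shift s v i) (+₃-inverseˡ r)) (shift-identity v i))

  shift-cancel : ∀ {d} r {v w} → shift r v ≡ᵥ shift r w [mod d ] → v ≡ᵥ w [mod d ]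
  shift-cancel {d} r {v} {w} v≡w i =
    subst₂ _≡_[mod d ] (shift-inverseˡ r v i) (shift-inverseˡ r w i) (v≡w (i +ₘ (-₃ r)))

  record ShiftClosed (P : V₃ → Set) : Set where
    field
      0∈     : P 0ᵥ
      +∈     : ∀ {v w} → P v → P w → P (v +ᵥ w)
      -∈     : ∀ {v} → P v → P (-ᵥ v)
      shift∈ : ∀ s {v} → P v → P (shift s v)

  record RotationSubgroup (Q : Fin 3 → Set) : Set where
    field
      0∈ : Q f0
      +∈ : ∀ {r s} → Q r → Q s → Q (r +ₘ s)
      -∈ : ∀ {r} → Q r → Q (-₃ r)

  allRotations : RotationSubgroup (λ _ → ⊤)
  allRotations = record { 0∈ = tt ; +∈ = λ _ _ → tt ; -∈ = λ _ → tt }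

  noRotation : RotationSubgroup (_≡ f0)
  noRotation = record { 0∈ = refl ; +∈ = λ { refl refl → refl } ; -∈ = λ { refl → refl } }

  zero-shiftClosed : ∀ {d} → ShiftClosed (_≡ᵥ 0ᵥ [mod d ])
  zero-shiftClosed = record
    { 0∈     = λ i → mod-refl
    ; +∈     = λ v≡0 w≡0 i → mod-trans (mod-+ (v≡0 i) (w≡0 i)) (mod-reflexive (ℤ.+-identityʳ 0ℤ))
    ; -∈     = λ v≡0 i → mod-neg (v≡0 i)
    ; shift∈ = λ s v≡0 i → v≡0 (i +ₘ s)
    }

  -- Affine maps of Fin d × Fin 3

  module ≈ {A : Set} = Setoid (A →-setoid A)
  module ≈-Reasoning {A : Set} = SetoidReasoning (A →-setoid A)

  ∘-cong : ∀ {A : Set} {f f′ g g′ : A → A} → f ≈ f′ → g ≈ g′ → (f ∘ g) ≈ (f′ ∘ g′)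
  ∘-cong {f′ = f′} f≈f′ g≈g′ x = trans (f≈f′ _) (cong f′ (g≈g′ x))

  Gen-mono : ∀ {A : Set} {S S′ : (A → A) → Set} → (∀ {f} → S f → Gen S′ f) → ∀ {f} → Gen S f → Gen S′ f
  Gen-mono S⊆ (gen s) = S⊆ s
  Gen-mono S⊆ one = one
  Gen-mono S⊆ (comp Gf Gg) = comp (Gen-mono S⊆ Gf) (Gen-mono S⊆ Gg)
  Gen-mono S⊆ (inv Gf f∘g g∘f) = inv (Gen-mono S⊆ Gf) f∘g g∘f
  Gen-mono S⊆ (ext Gf f≈g) = ext (Gen-mono S⊆ Gf) f≈g

  module Affine (d : ℕ) .{{_ : NonZero d}} where
    open Residue d

    residue-+0 : ∀ m → residue (toℤ m + 0ℤ) ≡ m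
    residue-+0 m = trans (cong residue (ℤ.+-identityʳ (toℤ m))) (residue-toℤ m)

    -- Opaque, so that unification can recover v and r from affine v r.
    opaque
      affine : V₃ → Fin 3 → Edge d → Edge d
      affine v r (m , i) = residue (toℤ m + v i) , i +ₘ r

      affine-apply : ∀ v r m i → affine v r (m , i) ≡ (residue (toℤ m + v i) , i +ₘ r)
      affine-apply v r m i = refl

      affine-cong : ∀ {v w r s} → v ≡ᵥ w [mod d ] → r ≡ s → affine v r ≈ affine w s
      affine-cong v≡w refl (m , i) = cong (_, _) (residue-cong (mod-+ (mod-refl {x = toℤ m}) (v≡w i)))

      affine-∘ : ∀ v r w s → (affine v r ∘ affine w s) ≈ affine (w +ᵥ shift s v) (s +ₘ r)
      affine-∘ v r w s (m , i) = cong₂ _,_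
        (residue-cong (mod-trans (mod-+ (toℤ-residue (toℤ m + w i)) mod-refl)
                                 (mod-reflexive (ℤ.+-assoc (toℤ m) (w i) (v (i +ₘ s))))))
        (+₃-assoc i s r)

      affine-identity : affine 0ᵥ f0 ≈ id
      affine-identity (m , i) = cong₂ _,_ (residue-+0 m) (+₃-identityʳ i)

      affine-injective : ∀ {v r w s} → affine v r ≈ affine w s → r ≡ s × v ≡ᵥ w [mod d ]
      affine-injective {v} {r} {w} {s} v≈w =
        trans (sym (+₃-identityˡ r)) (trans (cong proj₂ (v≈w (o , f0))) (+₃-identityˡ s)) ,
        λ i → mod-cancelˡ {z = toℤ o} (residue-injective {toℤ o + v i} {toℤ o + w i} (cong proj₁ (v≈w (o , i))))
        where o : Fin d
              o = residue 0ℤ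

    σ₀≈affine : σ₀ ≈ affine 0ᵥ (fs f0)
    σ₀≈affine (m , f0) = trans (cong (_, _) (sym (residue-+0 m))) (sym (affine-apply 0ᵥ (fs f0) m f0))
    σ₀≈affine (m , fs f0) = trans (cong (_, _) (sym (residue-+0 m))) (sym (affine-apply 0ᵥ (fs f0) m (fs f0)))
    σ₀≈affine (m , fs (fs f0)) = trans (cong (_, _) (sym (residue-+0 m))) (sym (affine-apply 0ᵥ (fs f0) m (fs (fs f0))))

    affine-inverseˡ : ∀ v r → (affine (-ᵥ shift (-₃ r) v) (-₃ r) ∘ affine v r) ≈ id
    affine-inverseˡ v r = ≈.trans (affine-∘ (-ᵥ shift (-₃ r) v) (-₃ r) v r)
      (≈.trans (affine-cong (λ i → mod-reflexive (trans (cong (λ z → v i + - z) (shift-inverseʳ r v i)) (ℤ.+-inverseʳ (v i))))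
                            (+₃-inverseʳ r))
               affine-identity)

    affine-≗ : ∀ {v w r} → (∀ i → v i ≡ w i) → affine v r ≈ affine w r
    affine-≗ v≗w = affine-cong (λ i → mod-reflexive (v≗w i)) refl

    translation-∘ : ∀ u w → (affine u f0 ∘ affine w f0) ≈ affine (u +ᵥ w) f0
    translation-∘ u w = begin
      affine u f0 ∘ affine w f0    ≈⟨ affine-∘ u f0 w f0 ⟩
      affine (w +ᵥ shift f0 u) f0  ≈⟨ affine-≗ (λ i → trans (cong (_+_ (w i)) (shift-identity u i)) (ℤ.+-comm (w i) (u i))) ⟩
      affine (u +ᵥ w) f0           ∎
      where open ≈-Reasoning

    translations-cancel : ∀ u w → (∀ i → u i + w i ≡ 0ℤ) → (affine u f0 ∘ affine w f0) ≈ id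
    translations-cancel u w u+w≡0 = begin
      affine u f0 ∘ affine w f0  ≈⟨ translation-∘ u w ⟩
      affine (u +ᵥ w) f0         ≈⟨ affine-≗ u+w≡0 ⟩
      affine 0ᵥ f0               ≈⟨ affine-identity ⟩
      id                         ∎
      where open ≈-Reasoning

    record AffineIn (P : V₃ → Set) (Q : Fin 3 → Set) (f : Edge d → Edge d) : Set where
      constructor affine-in
      field
        vec    : V₃
        rot    : Fin 3
        vec∈   : P vec
        rot∈   : Q rot
        f≈     : f ≈ affine vec rot

    module _ {P Q} (P-closed : ShiftClosed P) (Q-subgroup : RotationSubgroup Q) where
      private
        module P = ShiftClosed P-closed
        module Q = RotationSubgroup Q-subgroup

      Gen⇒AffineIn : ∀ {S} → (∀ {f} → S f → AffineIn P Q f) → ∀ {f} → Gen S f → AffineIn P Q f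
      Gen⇒AffineIn gens (gen s) = gens s
      Gen⇒AffineIn gens one = affine-in 0ᵥ f0 P.0∈ Q.0∈ (≈.sym affine-identity)
      Gen⇒AffineIn gens (comp Gf Gg) with Gen⇒AffineIn gens Gf | Gen⇒AffineIn gens Gg
      ... | affine-in v r v∈ r∈ f≈ | affine-in w s w∈ s∈ g≈ =
        affine-in (w +ᵥ shift s v) (s +ₘ r) (P.+∈ w∈ (P.shift∈ s v∈)) (Q.+∈ s∈ r∈)
          (≈.trans (∘-cong f≈ g≈) (affine-∘ v r w s))
      Gen⇒AffineIn gens (inv {f} {g} Gf f∘g≈id _) with Gen⇒AffineIn gens Gf
      ... | affine-in v r v∈ r∈ f≈ =
        affine-in (-ᵥ shift (-₃ r) v) (-₃ r) (P.-∈ (P.shift∈ (-₃ r) v∈)) (Q.-∈ r∈) g≈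
        where
          h : Edge d → Edge d
          h = affine (-ᵥ shift (-₃ r) v) (-₃ r)
          g≈ : g ≈ h
          g≈ x = begin
            g x                       ≡⟨ affine-inverseˡ v r (g x) ⟨
            h (affine v r (g x))      ≡⟨ cong h (f≈ (g x)) ⟨
            h (f (g x))               ≡⟨ cong h (f∘g≈id x) ⟩
            h x                       ∎
            where open ≡-Reasoning
      Gen⇒AffineIn gens (ext Gf f≈g) with Gen⇒AffineIn gens Gf
      ... | affine-in v r v∈ r∈ f≈ = affine-in v r v∈ r∈ (≈.trans (≈.sym f≈g) f≈)

  module Translations (d : ℕ) .{{_ : NonZero d}} {S : (Edge d → Edge d) → Set} where
    open Affine d

    translation-pow : ∀ u → Gen S (affine u f0) → ∀ N → Gen S (affine (+ N *ᵥ u) f0)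
    translation-pow u Gu zero = ext one (begin
      id                   ≈⟨ affine-identity ⟨
      affine 0ᵥ f0         ≈⟨ affine-≗ (λ i → sym (ℤ.*-zeroˡ (u i))) ⟩
      affine (0ℤ *ᵥ u) f0  ∎)
      where open ≈-Reasoning
    translation-pow u Gu (suc N) = ext (comp Gu (translation-pow u Gu N)) (begin
      affine u f0 ∘ affine (+ N *ᵥ u) f0  ≈⟨ translation-∘ u (+ N *ᵥ u) ⟩
      affine (u +ᵥ + N *ᵥ u) f0          ≈⟨ affine-≗ (λ i → lemma (+ N) (u i)) ⟩
      affine (+ suc N *ᵥ u) f0           ∎)
      where open ≈-Reasoning
            lemma : ∀ N x → x + N * x ≡ (1ℤ + N) * x
            lemma = solve-∀

    translation-neg : ∀ u → Gen S (affine u f0) → Gen S (affine (-ᵥ u) f0)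
    translation-neg u Gu = inv Gu
      (translations-cancel u (-ᵥ u) (λ i → ℤ.+-inverseʳ (u i)))
      (translations-cancel (-ᵥ u) u (λ i → ℤ.+-inverseˡ (u i)))

    translation-int : ∀ u → Gen S (affine u f0) → ∀ z → Gen S (affine (z *ᵥ u) f0)
    translation-int u Gu (+ N) = translation-pow u Gu N
    translation-int u Gu ℤ.-[1+ N ] = ext (translation-neg (+ suc N *ᵥ u) (translation-pow u Gu (suc N)))
      (affine-≗ (λ i → ℤ.neg-distribˡ-* (+ suc N) (u i)))

    rotation : Gen S σ₀ → ∀ r → Gen S (affine 0ᵥ r)
    rotation Gσ₀ f0 = ext one (≈.sym affine-identity)
    rotation Gσ₀ (fs f0) = ext Gσ₀ σ₀≈affine
    rotation Gσ₀ (fs (fs f0)) = ext (comp Gσ₀ Gσ₀) (begin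
      σ₀ ∘ σ₀                                  ≈⟨ ∘-cong σ₀≈affine σ₀≈affine ⟩
      affine 0ᵥ (fs f0) ∘ affine 0ᵥ (fs f0)    ≈⟨ affine-∘ 0ᵥ (fs f0) 0ᵥ (fs f0) ⟩
      affine 0ᵥ (fs (fs f0))                   ∎)
      where open ≈-Reasoning

  -- The lattice L = ℤa + ℤb + nℤ³

  module Lattice (p₀ p₁ p₂ : ℕ) where

    n : ℕ
    n = p₀ ℕ.+ p₁ ℕ.+ p₂

    P₀ P₁ P₂ : ℤ
    P₀ = + p₀
    P₁ = + p₁
    P₂ = + p₂

    +n≡ : + n ≡ P₀ + P₁ + P₂
    +n≡ = trans (ℤ.pos-+ (p₀ ℕ.+ p₁) p₂) (cong (_+ P₂) (ℤ.pos-+ p₀ p₁))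

    mod-n : ∀ q {x y} → x - y ≡ q * (P₀ + P₁ + P₂) → x ≡ y [mod n ]
    mod-n q eq = mod (divides q (trans eq (cong (q *_) (sym +n≡))))

    a b : V₃
    a f0 = P₁
    a (fs f0) = P₂
    a (fs (fs f0)) = P₀
    b = shift (fs f0) a

    record InLattice (v : V₃) : Set where
      constructor combination
      field
        x y          : ℤ
        ≡combination : v ≡ᵥ x *ᵥ a +ᵥ y *ᵥ b [mod n ]

    InLattice-resp : ∀ {v w} → v ≡ᵥ w [mod n ] → InLattice w → InLattice v
    InLattice-resp v≡w (combination x y w≡) = combination x y (λ i → mod-trans (v≡w i) (w≡ i))

    private
      combination-of : ∀ {v} x y → (∀ i → v i ≡ x * a i + y * b i) → InLattice v
      combination-of x y eq = combination x y (λ i → mod-reflexive (eq i))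

    0∈L : InLattice 0ᵥ
    0∈L = combination-of 0ℤ 0ℤ (λ i → sym (lemma (a i) (b i)))
      where lemma : ∀ A B → 0ℤ * A + 0ℤ * B ≡ 0ℤ
            lemma = solve-∀

    a∈L : InLattice a
    a∈L = combination-of 1ℤ 0ℤ (λ i → lemma (a i) (b i))
      where lemma : ∀ A B → A ≡ 1ℤ * A + 0ℤ * B
            lemma = solve-∀

    b∈L : InLattice b
    b∈L = combination-of 0ℤ 1ℤ (λ i → lemma (a i) (b i))
      where lemma : ∀ A B → B ≡ 0ℤ * A + 1ℤ * B
            lemma = solve-∀

    +∈L : ∀ {v w} → InLattice v → InLattice w → InLattice (v +ᵥ w)
    +∈L (combination x y v≡) (combination x′ y′ w≡) =
      combination (x + x′) (y + y′) (λ i → mod-trans (mod-+ (v≡ i) (w≡ i)) (mod-reflexive (lemma x y x′ y′ (a i) (b i))))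
      where lemma : ∀ x y x′ y′ A B → x * A + y * B + (x′ * A + y′ * B) ≡ (x + x′) * A + (y + y′) * B
            lemma = solve-∀

    *∈L : ∀ z {v} → InLattice v → InLattice (z *ᵥ v)
    *∈L z (combination x y v≡) =
      combination (z * x) (z * y) (λ i → mod-trans (mod-*ˡ z (v≡ i)) (mod-reflexive (lemma z x y (a i) (b i))))
      where lemma : ∀ z x y A B → z * (x * A + y * B) ≡ z * x * A + z * y * B
            lemma = solve-∀

    -∈L : ∀ {v} → InLattice v → InLattice (-ᵥ v)
    -∈L {v} v∈ = InLattice-resp (λ i → mod-reflexive (sym (ℤ.-1*i≡-i (v i)))) (*∈L ℤ.-1ℤ v∈)

    -- shift 1 a = b, and shift 1 b = (p₀, p₁, p₂) ≡ -a - b (mod n).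
    shift₁∈L : ∀ {v} → InLattice v → InLattice (shift (fs f0) v)
    shift₁∈L (combination x y v≡) =
      combination (- y) (x - y) (λ i → mod-trans (v≡ (i +ₘ fs f0)) (rotate i))
      where
        rotate : ∀ i → x * a (i +ₘ fs f0) + y * b (i +ₘ fs f0) ≡ - y * a i + (x - y) * b i [mod n ]
        rotate f0 = mod-n y (lemma x y P₀ P₁ P₂)
          where lemma : ∀ x y P₀ P₁ P₂ → x * P₂ + y * P₀ - (- y * P₁ + (x - y) * P₂) ≡ y * (P₀ + P₁ + P₂)
                lemma = solve-∀
        rotate (fs f0) = mod-n y (lemma x y P₀ P₁ P₂)
          where lemma : ∀ x y P₀ P₁ P₂ → x * P₀ + y * P₁ - (- y * P₂ + (x - y) * P₀) ≡ y * (P₀ + P₁ + P₂)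
                lemma = solve-∀
        rotate (fs (fs f0)) = mod-n y (lemma x y P₀ P₁ P₂)
          where lemma : ∀ x y P₀ P₁ P₂ → x * P₁ + y * P₂ - (- y * P₀ + (x - y) * P₁) ≡ y * (P₀ + P₁ + P₂)
                lemma = solve-∀

    shift∈L : ∀ s {v} → InLattice v → InLattice (shift s v)
    shift∈L f0 {v} v∈ = InLattice-resp (λ i → mod-reflexive (shift-identity v i)) v∈
    shift∈L (fs f0) v∈ = shift₁∈L v∈
    shift∈L (fs (fs f0)) {v} v∈ =
      InLattice-resp (λ i → mod-reflexive (sym (shift-shift (fs f0) (fs f0) v i))) (shift₁∈L (shift₁∈L v∈))

    L-shiftClosed : ShiftClosed InLattice
    L-shiftClosed = record { 0∈ = 0∈L ; +∈ = +∈L ; -∈ = -∈L ; shift∈ = shift∈L }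

  -- The monodromy group and its decomposition G = N ⋊ H

  module Monodromy (p₀ p₁ p₂ : ℕ) .{{_ : NonZero (p₀ ℕ.+ p₁ ℕ.+ p₂)}} where
    open Lattice p₀ p₁ p₂ public
    open Residue n public
    open Affine n public
    open Translations n

    σ₁≈affine : σ₁ p₀ p₁ p₂ ≈ affine (-ᵥ a) (fs (fs f0))
    σ₁≈affine (m , f0) = trans (cong (_, _) (-ₘ≡residue m p₁)) (sym (affine-apply (-ᵥ a) (fs (fs f0)) m f0))
    σ₁≈affine (m , fs f0) = trans (cong (_, _) (-ₘ≡residue m p₂)) (sym (affine-apply (-ᵥ a) (fs (fs f0)) m (fs f0)))
    σ₁≈affine (m , fs (fs f0)) = trans (cong (_, _) (-ₘ≡residue m p₀)) (sym (affine-apply (-ᵥ a) (fs (fs f0)) m (fs (fs f0))))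

    σ₀σ₁≈affine : (σ₀ ∘ σ₁ p₀ p₁ p₂) ≈ affine (-ᵥ a) f0
    σ₀σ₁≈affine = begin
      σ₀ ∘ σ₁ p₀ p₁ p₂                                 ≈⟨ ∘-cong σ₀≈affine σ₁≈affine ⟩
      affine 0ᵥ (fs f0) ∘ affine (-ᵥ a) (fs (fs f0))   ≈⟨ affine-∘ 0ᵥ (fs f0) (-ᵥ a) (fs (fs f0)) ⟩
      affine (-ᵥ a +ᵥ shift (fs (fs f0)) 0ᵥ) f0        ≈⟨ affine-≗ (λ i → ℤ.+-identityʳ (- a i)) ⟩
      affine (-ᵥ a) f0                                 ∎
      where open ≈-Reasoning

    σ₁σ₀≈affine : (σ₁ p₀ p₁ p₂ ∘ σ₀) ≈ affine (-ᵥ b) f0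
    σ₁σ₀≈affine = begin
      σ₁ p₀ p₁ p₂ ∘ σ₀                                 ≈⟨ ∘-cong σ₁≈affine σ₀≈affine ⟩
      affine (-ᵥ a) (fs (fs f0)) ∘ affine 0ᵥ (fs f0)   ≈⟨ affine-∘ (-ᵥ a) (fs (fs f0)) 0ᵥ (fs f0) ⟩
      affine (0ᵥ +ᵥ shift (fs f0) (-ᵥ a)) f0           ≈⟨ affine-≗ (λ i → ℤ.+-identityˡ (- b i)) ⟩
      affine (-ᵥ b) f0                                 ∎
      where open ≈-Reasoning

    G⊆affine : ∀ {f} → G p₀ p₁ p₂ f → AffineIn InLattice (λ _ → ⊤) f
    G⊆affine = Gen⇒AffineIn L-shiftClosed allRotations
      λ { (inj₁ refl) → affine-in 0ᵥ (fs f0) 0∈L tt σ₀≈affine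
        ; (inj₂ refl) → affine-in (-ᵥ a) (fs (fs f0)) (-∈L a∈L) tt σ₁≈affine }

    N⊆translations : ∀ {f} → N p₀ p₁ p₂ f → AffineIn InLattice (_≡ f0) f
    N⊆translations = Gen⇒AffineIn L-shiftClosed noRotation
      λ { (inj₁ refl) → affine-in (-ᵥ a) f0 (-∈L a∈L) refl σ₀σ₁≈affine
        ; (inj₂ refl) → affine-in (-ᵥ b) f0 (-∈L b∈L) refl σ₁σ₀≈affine }

    H⊆rotations : ∀ {f} → H p₀ p₁ p₂ f → AffineIn (_≡ᵥ 0ᵥ [mod n ]) (λ _ → ⊤) f
    H⊆rotations = Gen⇒AffineIn zero-shiftClosed allRotations
      λ { refl → affine-in 0ᵥ (fs f0) (λ _ → mod-refl) tt σ₀≈affine }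

    lattice-translation : ∀ {S} → Gen S (affine (-ᵥ a) f0) → Gen S (affine (-ᵥ b) f0) →
                          ∀ {v} → InLattice v → Gen S (affine v f0)
    lattice-translation Ga Gb {v} (combination x y v≡) =
      ext (comp (translation-int (-ᵥ a) Ga (- x)) (translation-int (-ᵥ b) Gb (- y))) (begin
        affine (- x *ᵥ -ᵥ a) f0 ∘ affine (- y *ᵥ -ᵥ b) f0  ≈⟨ translation-∘ (- x *ᵥ -ᵥ a) (- y *ᵥ -ᵥ b) ⟩
        affine (- x *ᵥ -ᵥ a +ᵥ - y *ᵥ -ᵥ b) f0              ≈⟨ affine-cong combination≡v refl ⟩
        affine v f0                                        ∎)
      where
        open ≈-Reasoning
        lemma : ∀ x y A B → - x * - A + - y * - B ≡ x * A + y * B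
        lemma = solve-∀
        combination≡v : - x *ᵥ -ᵥ a +ᵥ - y *ᵥ -ᵥ b ≡ᵥ v [mod n ]
        combination≡v i = mod-trans (mod-reflexive (lemma x y (a i) (b i))) (mod-sym (v≡ i))

    translation∈N : ∀ {v} → InLattice v → N p₀ p₁ p₂ (affine v f0)
    translation∈N = lattice-translation (ext (gen (inj₁ refl)) σ₀σ₁≈affine) (ext (gen (inj₂ refl)) σ₁σ₀≈affine)

    translation∈G : ∀ {v} → InLattice v → G p₀ p₁ p₂ (affine v f0)
    translation∈G = lattice-translation (ext (comp (gen (inj₁ refl)) (gen (inj₂ refl))) σ₀σ₁≈affine)
                                        (ext (comp (gen (inj₂ refl)) (gen (inj₁ refl))) σ₁σ₀≈affine)

    rotation∈H : ∀ r → H p₀ p₁ p₂ (affine 0ᵥ r)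
    rotation∈H = rotation (gen refl)

    affine∈G : ∀ {v} → InLattice v → ∀ r → G p₀ p₁ p₂ (affine v r)
    affine∈G {v} v∈ r = ext (comp (rotation (gen (inj₁ refl)) r) (translation∈G v∈)) (begin
      affine 0ᵥ r ∘ affine v f0    ≈⟨ affine-∘ 0ᵥ r v f0 ⟩
      affine (v +ᵥ shift f0 0ᵥ) (f0 +ₘ r) ≈⟨ affine-cong (λ i → mod-reflexive (ℤ.+-identityʳ (v i))) (+₃-identityˡ r) ⟩
      affine v r                   ∎)
      where open ≈-Reasoning

    N⊆G : ∀ {f} → N p₀ p₁ p₂ f → G p₀ p₁ p₂ f
    N⊆G = Gen-mono λ { (inj₁ refl) → comp (gen (inj₁ refl)) (gen (inj₂ refl))
                     ; (inj₂ refl) → comp (gen (inj₂ refl)) (gen (inj₁ refl)) }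

    H⊆G : ∀ {f} → H p₀ p₁ p₂ f → G p₀ p₁ p₂ f
    H⊆G = Gen-mono λ { refl → gen (inj₁ refl) }

    conjugate-translation : ∀ {v r v′ r′ w} → InLattice v → InLattice v′ → InLattice w →
                            (affine v r ∘ affine v′ r′) ≈ id →
                            N p₀ p₁ p₂ (affine v r ∘ affine w f0 ∘ affine v′ r′)
    conjugate-translation {v} {r} {v′} {r′} {w} v∈ v′∈ w∈ g∘g′≈id = ext (translation∈N X∈L) (≈.sym (begin
      affine v r ∘ affine w f0 ∘ affine v′ r′      ≈⟨ ∘-cong {f = affine v r} ≈.refl (affine-∘ w f0 v′ r′) ⟩
      affine v r ∘ affine W (r′ +ₘ f0)             ≈⟨ affine-∘ v r W (r′ +ₘ f0) ⟩
      affine X ((r′ +ₘ f0) +ₘ r)                   ≈⟨ affine-cong (λ _ → mod-refl) rotation≡0 ⟩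
      affine X f0                                  ∎))
      where
        open ≈-Reasoning
        W X : V₃
        W = v′ +ᵥ shift r′ w
        X = W +ᵥ shift (r′ +ₘ f0) v
        X∈L : InLattice X
        X∈L = +∈L (+∈L v′∈ (shift∈L r′ w∈)) (shift∈L (r′ +ₘ f0) v∈)
        r′+r≡0 : r′ +ₘ r ≡ f0
        r′+r≡0 = proj₁ (affine-injective
          (≈.trans (≈.sym (affine-∘ v r v′ r′)) (≈.trans g∘g′≈id (≈.sym affine-identity))))
        rotation≡0 : (r′ +ₘ f0) +ₘ r ≡ f0
        rotation≡0 = trans (cong (_+ₘ r) (+₃-identityʳ r′)) r′+r≡0

    N-normal : ∀ {g g′ x} → G p₀ p₁ p₂ g → (g ∘ g′) ≈ id → (g′ ∘ g) ≈ id →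
               N p₀ p₁ p₂ x → N p₀ p₁ p₂ (g ∘ x ∘ g′)
    N-normal Gg g∘g′≈id g′∘g≈id Nx =
      conjugate (G⊆affine Gg) (G⊆affine (inv Gg g∘g′≈id g′∘g≈id)) (N⊆translations Nx) g∘g′≈id
      where
        conjugate : ∀ {g g′ x} → AffineIn InLattice (λ _ → ⊤) g → AffineIn InLattice (λ _ → ⊤) g′ →
                    AffineIn InLattice (_≡ f0) x → (g ∘ g′) ≈ id → N p₀ p₁ p₂ (g ∘ x ∘ g′)
        conjugate (affine-in v r v∈ _ g≈) (affine-in v′ r′ v′∈ _ g′≈) (affine-in w _ w∈ refl x≈) g∘g′≈id =
          ext (conjugate-translation v∈ v′∈ w∈ (≈.trans (≈.sym (∘-cong g≈ g′≈)) g∘g′≈id))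
              (≈.sym (∘-cong g≈ (∘-cong x≈ g′≈)))

    N∩H≈id : ∀ {x} → N p₀ p₁ p₂ x → H p₀ p₁ p₂ x → x ≈ id
    N∩H≈id {x} Nx Hx with N⊆translations Nx | H⊆rotations Hx
    ... | affine-in w .f0 _ refl x≈ | affine-in z r z≡0 _ x≈′ = begin
      x             ≈⟨ x≈′ ⟩
      affine z r    ≈⟨ affine-cong z≡0 (sym f0≡r) ⟩
      affine 0ᵥ f0  ≈⟨ affine-identity ⟩
      id            ∎
      where
        open ≈-Reasoning
        f0≡r : f0 ≡ r
        f0≡r = proj₁ (affine-injective (≈.trans (≈.sym x≈) x≈′))

    G⊆NH : ∀ {g} → G p₀ p₁ p₂ g →
           Σ (Edge n → Edge n) λ t → Σ (Edge n → Edge n) λ h → N p₀ p₁ p₂ t × H p₀ p₁ p₂ h × g ≈ (t ∘ h)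
    G⊆NH {g} Gg with G⊆affine Gg
    ... | affine-in v r v∈ _ g≈ =
      affine (shift (-₃ r) v) f0 , affine 0ᵥ r , translation∈N (shift∈L (-₃ r) v∈) , rotation∈H r , (begin
        g                                               ≈⟨ g≈ ⟩
        affine v r                                      ≈⟨ affine-cong untwist (sym (+₃-identityʳ r)) ⟩
        affine (0ᵥ +ᵥ shift r (shift (-₃ r) v)) (r +ₘ f0)  ≈⟨ affine-∘ (shift (-₃ r) v) f0 0ᵥ r ⟨
        affine (shift (-₃ r) v) f0 ∘ affine 0ᵥ r        ∎)
      where
        open ≈-Reasoning
        untwist : v ≡ᵥ 0ᵥ +ᵥ shift r (shift (-₃ r) v) [mod n ]
        untwist i = mod-reflexive (sym (trans (ℤ.+-identityˡ _) (shift-inverseʳ r v i)))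

    semidirect : InternalSemidirect (G p₀ p₁ p₂) (N p₀ p₁ p₂) (H p₀ p₁ p₂)
    semidirect = record
      { N⊆G    = N⊆G
      ; H⊆G    = H⊆G
      ; normal = N-normal
      ; N∩H    = N∩H≈id
      ; NH⊆G   = λ Nt Hh → comp (N⊆G Nt) (H⊆G Hh)
      ; G⊆NH   = G⊆NH
      }

  -- The invariant α = gcd(n, p₀p₁ - p₂²) and the coordinates of L/nℤ³

  module GcdInvariant (p₀ p₁ p₂ : ℕ) where
    open Lattice p₀ p₁ p₂ using (n; P₀; P₁; P₂)

    D : ℤ
    D = P₀ * P₁ - P₂ * P₂

    α : ℕ
    α = gcd n ℕ.∣ p₀ ℕ.* p₁ - p₂ ℕ.* p₂ ∣

    ∣D∣≡ : ℤ.∣ D ∣ ≡ ℕ.∣ p₀ ℕ.* p₁ - p₂ ℕ.* p₂ ∣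
    ∣D∣≡ = trans (cong ℤ.∣_∣ (sym (cong₂ _-_ (ℤ.pos-* p₀ p₁) (ℤ.pos-* p₂ p₂))))
                 (∣+m-+n∣≡∣m-n∣ (p₀ ℕ.* p₁) (p₂ ℕ.* p₂))

    α∣n : + α ∣ + n
    α∣n = ∣ᵤ⇒∣ (gcd[m,n]∣m n _)

    α∣D : + α ∣ D
    α∣D = ∣ᵤ⇒∣ (subst (α ℕ.∣_) (sym ∣D∣≡) (gcd[m,n]∣n n _))

    α-bézout : ∃₂ λ A B → + α ≡ A * + n + B * D
    α-bézout = subst (λ m → ∃₂ λ A B → + gcd n m ≡ A * + n + B * D) ∣D∣≡ (gcd-bézout-∣∣ n D)

    module _ (gcd₃≡1 : gcd (gcd p₀ p₁) p₂ ≡ 1) where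

      common-divisor≡1 : ∀ {d} → d ℕ.∣ p₀ → d ℕ.∣ p₁ → d ℕ.∣ p₂ → d ≡ 1
      common-divisor≡1 d∣p₀ d∣p₁ d∣p₂ =
        ℕ.∣1⇒≡1 (subst (_ ℕ.∣_) gcd₃≡1 (gcd-greatest (gcd-greatest d∣p₀ d∣p₁) d∣p₂))

      ∣p₀ : ∀ {d} → d ℕ.∣ n → d ℕ.∣ p₁ → d ℕ.∣ p₂ → d ℕ.∣ p₀
      ∣p₀ {d} d∣n d∣p₁ d∣p₂ = ℕ.∣m+n∣m⇒∣n (subst (d ℕ.∣_) (ℕ.+-comm p₀ p₁) d∣p₀+p₁) d∣p₁
        where d∣p₀+p₁ : d ℕ.∣ p₀ ℕ.+ p₁
              d∣p₀+p₁ = ℕ.∣m+n∣m⇒∣n (subst (d ℕ.∣_) (ℕ.+-comm (p₀ ℕ.+ p₁) p₂) d∣n) d∣p₂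

      -- A common divisor of p₁ and α divides p₂² = p₀p₁ - D, hence p₂ (being coprime to it), hence p₀.
      α-coprime-p₁ : Coprime α p₁
      α-coprime-p₁ {d} (d∣α , d∣p₁) = common-divisor≡1 (∣p₀ d∣n d∣p₁ d∣p₂) d∣p₁ d∣p₂
        where
          d∣n : d ℕ.∣ n
          d∣n = ℕ.∣-trans d∣α (gcd[m,n]∣m n _)
          d∣D : + d ∣ D
          d∣D = ∣-trans (∣ᵤ⇒∣ d∣α) α∣D
          d∣p₂² : + d ∣ P₂ * P₂
          d∣p₂² = subst (+ d ∣_) (lemma P₀ P₁ P₂) (∣m∣n⇒∣m-n (∣n⇒∣m*n P₀ (∣ᵤ⇒∣ d∣p₁)) d∣D)
            where lemma : ∀ P₀ P₁ P₂ → P₀ * P₁ - (P₀ * P₁ - P₂ * P₂) ≡ P₂ * P₂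
                  lemma = solve-∀
          d-coprime-p₂ : Coprime d p₂
          d-coprime-p₂ (e∣d , e∣p₂) =
            common-divisor≡1 (∣p₀ (ℕ.∣-trans e∣d d∣n) (ℕ.∣-trans e∣d d∣p₁) e∣p₂) (ℕ.∣-trans e∣d d∣p₁) e∣p₂
          d∣p₂ : d ℕ.∣ p₂
          d∣p₂ = coprime-divisor d-coprime-p₂ (subst (d ℕ.∣_) (ℤ.abs-* P₂ P₂) (∣⇒∣ᵤ d∣p₂²))

      unit-bézout : Σ ℤ λ X → Σ ℤ λ Y → Σ ℤ λ Z → X * P₀ + Y * P₁ + Z * P₂ ≡ 1ℤ
      unit-bézout with bézout (gcd p₀ p₁) p₂ | bézout p₀ p₁
      ... | A , B , eq | C , E , eq′ = A * C , A * E , B , sym (begin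
        1ℤ                                   ≡⟨ cong +_ (sym gcd₃≡1) ⟩
        + gcd (gcd p₀ p₁) p₂                 ≡⟨ eq ⟩
        A * + gcd p₀ p₁ + B * P₂             ≡⟨ cong (λ g → A * g + B * P₂) eq′ ⟩
        A * (C * P₀ + E * P₁) + B * P₂       ≡⟨ lemma A B C E P₀ P₁ P₂ ⟩
        A * C * P₀ + A * E * P₁ + B * P₂     ∎)
        where
          open ≡-Reasoning
          lemma : ∀ A B C E P₀ P₁ P₂ → A * (C * P₀ + E * P₁) + B * P₂ ≡ A * C * P₀ + A * E * P₁ + B * P₂
          lemma = solve-∀

  module Coordinates (p₀ p₁ p₂ : ℕ) .{{n-nonZero : NonZero (p₀ ℕ.+ p₁ ℕ.+ p₂)}}
                     (gcd₃≡1 : gcd (gcd p₀ p₁) p₂ ≡ 1)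
                     (k : ℕ) (k*α≡n : k ℕ.* GcdInvariant.α p₀ p₁ p₂ ≡ p₀ ℕ.+ p₁ ℕ.+ p₂) where
    open Monodromy p₀ p₁ p₂
    open GcdInvariant p₀ p₁ p₂
    module Rₖ = Residue k

    instance
      k-nonZero : NonZero k
      k-nonZero = ℕ.m*n≢0⇒m≢0 k {{subst NonZero (sym k*α≡n) n-nonZero}}
      α-nonZero : NonZero α
      α-nonZero = ℕ.m*n≢0⇒n≢0 k {{subst NonZero (sym k*α≡n) n-nonZero}}

    mod-kα : ∀ {x y} → x ≡ y [mod k ℕ.* α ] → x ≡ y [mod n ]
    mod-kα {x} {y} = subst (λ m → x ≡ y [mod m ]) k*α≡n

    mod-n⇒mod-kα : ∀ {x y} → x ≡ y [mod n ] → x ≡ y [mod k ℕ.* α ]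
    mod-n⇒mod-kα {x} {y} = subst (λ m → x ≡ y [mod m ]) (sym k*α≡n)

    X Y Z : ℤ
    X = proj₁ (unit-bézout gcd₃≡1)
    Y = proj₁ (proj₂ (unit-bézout gcd₃≡1))
    Z = proj₁ (proj₂ (proj₂ (unit-bézout gcd₃≡1)))

    ℓ : V₃
    ℓ = X *ᵥ a +ᵥ Y *ᵥ b +ᵥ Z *ᵥ shift (fs (fs f0)) a

    ℓ∈L : InLattice ℓ
    ℓ∈L = +∈L (+∈L (*∈L X a∈L) (*∈L Y b∈L)) (*∈L Z (shift∈L (fs (fs f0)) a∈L))

    ℓ₂≡1 : ℓ (fs (fs f0)) ≡ 1ℤ
    ℓ₂≡1 = proj₂ (proj₂ (proj₂ (unit-bézout gcd₃≡1)))

    β : V₃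
    β f0 = 1ℤ
    β (fs f0) = - 1ℤ
    β (fs (fs f0)) = 0ℤ

    -- From α = A n + B D, using p₀p₂ - p₁² ≡ D ≡ p₁p₂ - p₀² (mod n).
    αβ∈L : InLattice (+ α *ᵥ β)
    αβ∈L with α-bézout
    ... | A , B , α≡ = combination (- B * P₁) (B * P₀) coordinates
      where
        coordinates : ∀ i → + α * β i ≡ - B * P₁ * a i + B * P₀ * b i [mod n ]
        coordinates f0 = mod-n (A + B * (P₁ - P₂))
          (trans (cong (λ z → z * 1ℤ - (- B * P₁ * P₁ + B * P₀ * P₂)) α≡) (lemma A B P₀ P₁ P₂))
          where lemma : ∀ A B P₀ P₁ P₂ →
                        (A * (P₀ + P₁ + P₂) + B * (P₀ * P₁ - P₂ * P₂)) * 1ℤ - (- B * P₁ * P₁ + B * P₀ * P₂)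
                        ≡ (A + B * (P₁ - P₂)) * (P₀ + P₁ + P₂)
                lemma = solve-∀
        coordinates (fs f0) = mod-n (- A - B * (P₀ - P₂))
          (trans (cong (λ z → z * - 1ℤ - (- B * P₁ * P₂ + B * P₀ * P₀)) α≡) (lemma A B P₀ P₁ P₂))
          where lemma : ∀ A B P₀ P₁ P₂ →
                        (A * (P₀ + P₁ + P₂) + B * (P₀ * P₁ - P₂ * P₂)) * - 1ℤ - (- B * P₁ * P₂ + B * P₀ * P₀)
                        ≡ (- A - B * (P₀ - P₂)) * (P₀ + P₁ + P₂)
                lemma = solve-∀
        coordinates (fs (fs f0)) = mod-n 0ℤ (lemma (+ α) B P₀ P₁ P₂)
          where lemma : ∀ α B P₀ P₁ P₂ → α * 0ℤ - (- B * P₁ * P₀ + B * P₀ * P₁) ≡ 0ℤ * (P₀ + P₁ + P₂)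
                lemma = solve-∀

    sum≡0 : ∀ {v} → InLattice v → v f0 + v (fs f0) + v (fs (fs f0)) ≡ 0ℤ [mod n ]
    sum≡0 {v} (combination x y v≡) =
      mod-trans (mod-+ (mod-+ (v≡ f0) (v≡ (fs f0))) (v≡ (fs (fs f0)))) (mod-n (x + y) (lemma x y P₀ P₁ P₂))
      where lemma : ∀ x y P₀ P₁ P₂ →
                    x * P₁ + y * P₂ + (x * P₂ + y * P₀) + (x * P₀ + y * P₁) - 0ℤ ≡ (x + y) * (P₀ + P₁ + P₂)
            lemma = solve-∀

    α∣λ : ∀ {v} → InLattice v → + α ∣ P₀ * v f0 - P₂ * v (fs f0)
    α∣λ {v} (combination x y v≡) = ∣-resp-mod α∣n λ≡xD (∣n⇒∣m*n x α∣D)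
      where
        lemma : ∀ x y P₀ P₁ P₂ → P₀ * (x * P₁ + y * P₂) - P₂ * (x * P₂ + y * P₀) ≡ x * (P₀ * P₁ - P₂ * P₂)
        lemma = solve-∀
        λ≡xD : P₀ * v f0 - P₂ * v (fs f0) ≡ x * D [mod n ]
        λ≡xD = mod-trans (mod-+ (mod-*ˡ P₀ (v≡ f0)) (mod-neg (mod-*ˡ P₂ (v≡ (fs f0)))))
                         (mod-reflexive (lemma x y P₀ P₁ P₂))

    α∣first : ∀ {w} → InLattice w → w (fs (fs f0)) ≡ 0ℤ [mod n ] → + α ∣ w f0
    α∣first {w} w∈ w₂≡0 = ∣ᵤ⇒∣ (ℤ.coprime-divisor (+ α) P₁ (w f0) (α-coprime-p₁ gcd₃≡1) (∣⇒∣ᵤ α∣p₁w₀))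
      where
        w₁≡-w₀ : w (fs f0) ≡ - w f0 [mod n ]
        w₁≡-w₀ = mod-trans (mod-reflexive (lemma (w f0) (w (fs f0)) (w (fs (fs f0)))))
                   (mod-trans (mod-+ (mod-+ (sum≡0 w∈) mod-refl) (mod-neg w₂≡0)) (mod-reflexive (lemma′ (w f0))))
          where lemma : ∀ x y z → y ≡ x + y + z + - x - z
                lemma = solve-∀
                lemma′ : ∀ x → 0ℤ + - x - 0ℤ ≡ - x
                lemma′ = solve-∀
        λ≡-p₁w₀ : P₀ * w f0 - P₂ * w (fs f0) ≡ - (P₁ * w f0) [mod n ]
        λ≡-p₁w₀ = mod-trans (mod-+ (mod-refl {x = P₀ * w f0}) (mod-neg (mod-*ˡ P₂ w₁≡-w₀)))
                    (mod-n (w f0) (lemma P₀ P₁ P₂ (w f0)))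
          where lemma : ∀ P₀ P₁ P₂ w → P₀ * w - P₂ * - w - - (P₁ * w) ≡ w * (P₀ + P₁ + P₂)
                lemma = solve-∀
        α∣p₁w₀ : + α ∣ P₁ * w f0
        α∣p₁w₀ = subst (+ α ∣_) (ℤ.neg-involutive _) (∣m⇒∣-m (∣-resp-mod α∣n (mod-sym λ≡-p₁w₀) (α∣λ w∈)))

    lattice-ext : ∀ {v w} → InLattice v → InLattice w →
                  v f0 ≡ w f0 [mod n ] → v (fs (fs f0)) ≡ w (fs (fs f0)) [mod n ] → v ≡ᵥ w [mod n ]
    lattice-ext v∈ w∈ v₀≡w₀ v₂≡w₂ f0 = v₀≡w₀
    lattice-ext {v} {w} v∈ w∈ v₀≡w₀ v₂≡w₂ (fs f0) =
      mod-trans (mod-reflexive (lemma (v f0) (v (fs f0)) (v (fs (fs f0)))))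
        (mod-trans (mod-+ (mod-+ (mod-trans (sum≡0 v∈) (mod-sym (sum≡0 w∈))) (mod-neg v₀≡w₀)) (mod-neg v₂≡w₂))
          (mod-reflexive (sym (lemma (w f0) (w (fs f0)) (w (fs (fs f0)))))))
      where lemma : ∀ x y z → y ≡ x + y + z + - x + - z
            lemma = solve-∀
    lattice-ext v∈ w∈ v₀≡w₀ v₂≡w₂ (fs (fs f0)) = v₂≡w₂

    -- A vector of L is determined mod n by its last coordinate t and by the first coordinate of
    -- v - t ℓ, which is a multiple of α.
    encode : Fin n × Fin k → V₃
    encode (t , j) = toℤ t *ᵥ ℓ +ᵥ (toℤ j * + α) *ᵥ β

    encode₀ : ∀ t j → encode (t , j) f0 ≡ toℤ t * ℓ f0 + toℤ j * + α
    encode₀ t j = cong (_+_ (toℤ t * ℓ f0)) (ℤ.*-identityʳ (toℤ j * + α))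

    encode₂ : ∀ t j → encode (t , j) (fs (fs f0)) ≡ toℤ t
    encode₂ t j = trans (cong₂ _+_ (cong (toℤ t *_) ℓ₂≡1) (ℤ.*-zeroʳ (toℤ j * + α)))
                        (trans (ℤ.+-identityʳ _) (ℤ.*-identityʳ (toℤ t)))

    encode∈L : ∀ x → InLattice (encode x)
    encode∈L (t , j) = +∈L (*∈L (toℤ t) ℓ∈L)
      (InLattice-resp (λ i → mod-reflexive (ℤ.*-assoc (toℤ j) (+ α) (β i))) (*∈L (toℤ j) αβ∈L))

    encode-⊕ : ∀ x y → encode (x ⊕ y) ≡ᵥ encode x +ᵥ encode y [mod n ]
    encode-⊕ (t , j) (t′ , j′) i =
      mod-trans (mod-+ (mod-*ʳ (ℓ i) (toℤ-+ₘ t t′)) (mod-*ʳ (β i) (mod-kα (mod-*-scale α (Rₖ.toℤ-+ₘ j j′)))))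
                (mod-reflexive (lemma (toℤ t) (toℤ t′) (toℤ j) (toℤ j′) (+ α) (ℓ i) (β i)))
      where lemma : ∀ t t′ j j′ α ℓ β →
                    (t + t′) * ℓ + (j + j′) * α * β ≡ t * ℓ + j * α * β + (t′ * ℓ + j′ * α * β)
            lemma = solve-∀

    encode-injective : ∀ x y → encode x ≡ᵥ encode y [mod n ] → x ≡ y
    encode-injective (t , j) (t′ , j′) e = cong₂ _,_ t≡t′ (toℤ-injective-mod (mod-*-cancel α (mod-n⇒mod-kα jα≡j′α)))
      where
        t≡t′ : t ≡ t′
        t≡t′ = toℤ-injective-mod (subst₂ _≡_[mod n ] (encode₂ t j) (encode₂ t′ j′) (e (fs (fs f0))))
        jα≡j′α : toℤ j * + α ≡ toℤ j′ * + α [mod n ]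
        jα≡j′α = mod-cancelˡ {z = toℤ t * ℓ f0} (subst₂ _≡_[mod n ] (encode₀ t j)
          (trans (encode₀ t′ j′) (cong (λ s → toℤ s * ℓ f0 + toℤ j′ * + α) (sym t≡t′))) (e f0))

    reduced : V₃ → V₃
    reduced v = v +ᵥ -ᵥ (toℤ (residue (v (fs (fs f0)))) *ᵥ ℓ)

    decode : V₃ → Fin n × Fin k
    decode v = residue (v (fs (fs f0))) , Rₖ.residue (reduced v f0 ℤ./ℕ α)

    encode-decode : ∀ {v} → InLattice v → encode (decode v) ≡ᵥ v [mod n ]
    encode-decode {v} v∈ = lattice-ext (encode∈L (decode v)) v∈ first-coordinate third-coordinate
      where
        t : Fin n
        t = residue (v (fs (fs f0)))
        q : ℤ
        q = reduced v f0 ℤ./ℕ α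
        j : Fin k
        j = Rₖ.residue q
        t≡v₂ : toℤ t ≡ v (fs (fs f0)) [mod n ]
        t≡v₂ = toℤ-residue (v (fs (fs f0)))
        reduced₂≡0 : reduced v (fs (fs f0)) ≡ 0ℤ [mod n ]
        reduced₂≡0 = mod-trans (mod-+ (mod-refl {x = v (fs (fs f0))}) (mod-neg (mod-*ˡ (toℤ t) (mod-reflexive ℓ₂≡1))))
                       (mod-trans (mod-+ (mod-sym t≡v₂) mod-refl) (mod-reflexive (lemma (toℤ t))))
          where lemma : ∀ t → t + - (t * 1ℤ) ≡ 0ℤ
                lemma = solve-∀
        qα≡reduced₀ : q * + α ≡ reduced v f0
        qα≡reduced₀ = /ℕ-exact (α∣first (+∈L v∈ (-∈L (*∈L (toℤ t) ℓ∈L))) reduced₂≡0)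
        first-coordinate : encode (decode v) f0 ≡ v f0 [mod n ]
        first-coordinate = mod-trans (mod-reflexive (encode₀ t j))
          (mod-trans (mod-+ (mod-refl {x = toℤ t * ℓ f0}) (mod-kα (mod-*-scale α (Rₖ.toℤ-residue q))))
                     (mod-reflexive (trans (cong (_+_ (toℤ t * ℓ f0)) qα≡reduced₀) (lemma (toℤ t * ℓ f0) (v f0)))))
          where lemma : ∀ x v → x + (v + - x) ≡ v
                lemma = solve-∀
        third-coordinate : encode (decode v) (fs (fs f0)) ≡ v (fs (fs f0)) [mod n ]
        third-coordinate = mod-trans (mod-reflexive (encode₂ t j)) t≡v₂

    φ : Fin 3 → Fin n × Fin k → Fin n × Fin k
    φ h x = decode (shift (-₃ h) (encode x))

    encode-φ : ∀ h x → encode (φ h x) ≡ᵥ shift (-₃ h) (encode x) [mod n ]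
    encode-φ h x = encode-decode (shift∈L (-₃ h) (encode∈L x))

    φ-hom : ∀ h x y → φ h (x ⊕ y) ≡ φ h x ⊕ φ h y
    φ-hom h x y = encode-injective _ _ λ i →
      mod-trans (encode-φ h (x ⊕ y) i)
      (mod-trans (encode-⊕ x y (i +ₘ (-₃ h)))
      (mod-trans (mod-+ (mod-sym (encode-φ h x i)) (mod-sym (encode-φ h y i)))
                 (mod-sym (encode-⊕ (φ h x) (φ h y) i))))

    φ-zero : ∀ x → φ f0 x ≡ x
    φ-zero x = encode-injective _ _ λ i →
      mod-trans (encode-φ f0 x i) (mod-reflexive (shift-identity (encode x) i))

    φ-add : ∀ h h′ x → φ (h +ₘ h′) x ≡ φ h (φ h′ x)
    φ-add h h′ x = encode-injective _ _ λ i →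
      mod-trans (encode-φ (h +ₘ h′) x i)
      (mod-trans (mod-reflexive (trans (cong (λ s → shift s (encode x) i) (-₃-+ h h′))
                                       (sym (shift-shift (-₃ h) (-₃ h′) (encode x) i))))
      (mod-trans (mod-sym (encode-φ h′ x (i +ₘ (-₃ h))))
                 (mod-sym (encode-φ h (φ h′ x) i))))

    action : C₃Action n k
    action = record { φ = φ ; φ-hom = φ-hom ; φ-zero = φ-zero ; φ-add = φ-add }

    embed : SD n k → Edge n → Edge n
    embed (x , r) = affine (shift r (encode x)) r

    embed-hom : ∀ x y → embed (sdMul action x y) ≈ (embed x ∘ embed y)
    embed-hom (x , r) (y , r′) = begin
      affine (shift (r +ₘ r′) (encode (x ⊕ φ r y))) (r +ₘ r′)  ≈⟨ affine-cong vectors (+₃-comm r r′) ⟩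
      affine (shift r′ (encode y) +ᵥ shift r′ (shift r (encode x))) (r′ +ₘ r)
                                                                ≈⟨ affine-∘ (shift r (encode x)) r (shift r′ (encode y)) r′ ⟨
      affine (shift r (encode x)) r ∘ affine (shift r′ (encode y)) r′  ∎
      where
        open ≈-Reasoning
        vectors : shift (r +ₘ r′) (encode (x ⊕ φ r y)) ≡ᵥ shift r′ (encode y) +ᵥ shift r′ (shift r (encode x)) [mod n ]
        vectors i =
          mod-trans (encode-⊕ x (φ r y) (i +ₘ (r +ₘ r′)))
          (mod-trans (mod-+ (mod-reflexive (cong (encode x) (+₃-rotate i r r′)))
                            (mod-trans (encode-φ r y (i +ₘ (r +ₘ r′))) (mod-reflexive (cong (encode y) (+₃-cancel i r r′)))))
                     (mod-reflexive (ℤ.+-comm (encode x ((i +ₘ r′) +ₘ r)) (encode y (i +ₘ r′)))))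

    embed-injective : ∀ x y → embed x ≈ embed y → x ≡ y
    embed-injective (x , r) (y , r′) e = cong₂ _,_ (encode-injective x y (shift-cancel r shifted≡)) r≡r′
      where
        r≡r′ : r ≡ r′
        r≡r′ = proj₁ (affine-injective e)
        shifted≡ : shift r (encode x) ≡ᵥ shift r (encode y) [mod n ]
        shifted≡ = subst (λ s → shift r (encode x) ≡ᵥ shift s (encode y) [mod n ]) (sym r≡r′) (proj₂ (affine-injective e))

    embed∈G : ∀ x → G p₀ p₁ p₂ (embed x)
    embed∈G (x , r) = affine∈G (shift∈L r (encode∈L x)) r

    embed-onto : ∀ {g} → G p₀ p₁ p₂ g → Σ (SD n k) λ x → embed x ≈ g
    embed-onto Gg = preimage (G⊆affine Gg)
      where
        preimage : ∀ {g} → AffineIn InLattice (λ _ → ⊤) g → Σ (SD n k) λ x → embed x ≈ g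
        preimage (affine-in v r v∈ _ g≈) = (decode (shift (-₃ r) v) , r) , ≈.trans (affine-cong vectors refl) (≈.sym g≈)
          where
            vectors : shift r (encode (decode (shift (-₃ r) v))) ≡ᵥ v [mod n ]
            vectors i = mod-trans (encode-decode (shift∈L (-₃ r) v∈) (i +ₘ r)) (mod-reflexive (shift-inverseʳ r v i))

    isomorphism : IsoOnto (sdMul action) (G p₀ p₁ p₂)
    isomorphism = record
      { to      = embed
      ; to-in   = embed∈G
      ; to-hom  = embed-hom
      ; to-inj  = embed-injective
      ; to-surj = embed-onto
      }

  sum-nonZero : ∀ {p₀} p₁ p₂ → 0 ℕ.< p₀ → NonZero (p₀ ℕ.+ p₁ ℕ.+ p₂)
  sum-nonZero {p₀} p₁ p₂ 0<p₀ =
    ℕ.>-nonZero (ℕ.<-≤-trans 0<p₀ (ℕ.≤-trans (ℕ.m≤m+n p₀ p₁) (ℕ.m≤m+n (p₀ ℕ.+ p₁) p₂)))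

open import Data.Nat using (ℕ; _+_; _*_; _<_; ∣_-_∣)
open import Data.Nat.GCD using (gcd)
open import Data.Product using (_×_; Σ)
open import Relation.Binary.PropositionalEquality using (_≡_)
open import Data.Product using (_,_)

theorem1 : (p₀ p₁ p₂ : ℕ) → 0 < p₀ → 0 < p₁ → 0 < p₂ →
    gcd (gcd p₀ p₁) p₂ ≡ 1 →
    InternalSemidirect (G p₀ p₁ p₂) (N p₀ p₁ p₂) (H p₀ p₁ p₂)
    × ((k : ℕ) → k * gcd (p₀ + p₁ + p₂) ∣ p₀ * p₁ - p₂ * p₂ ∣ ≡ p₀ + p₁ + p₂ →
        Σ (C₃Action (p₀ + p₁ + p₂) k)
          (λ act → IsoOnto (sdMul act) (G p₀ p₁ p₂)))
theorem1 p₀ p₁ p₂ 0<p₀ _ _ gcd₃≡1 =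
  Monodromy.semidirect p₀ p₁ p₂ ,
  λ k k*α≡n → Coordinates.action p₀ p₁ p₂ gcd₃≡1 k k*α≡n , Coordinates.isomorphism p₀ p₁ p₂ gcd₃≡1 k k*α≡n
  where
    instance _ = sum-nonZero p₁ p₂ 0<p₀
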